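{- For integers $m\ge0$ and $0\le r<q^m$, and all $x\in\mathbf F_q[[T]]$, $$\Delta_{r,m}(x)^{q^m}=\sum_{n=r}^{q^m-1}\binom{n}{r}(-T)^{n-r}\mathcal D_n(x).$$ In particular $\Delta_{q^m-1,m}(x)^{q^m}=\mathcal D_{q^m-1}(x)$.
   Context: $q$ is a power of a prime. $\Delta_{r,m}(\sum_{n\ge0}x_nT^n)=\sum_{n\ge0}x_{nq^m+r}T^n$ for $0\le r<q^m$. The Hasse derivatives are $\mathcal D_n(\sum_{i\ge0}x_iT^i)=\sum_{i\ge n}\binom{i}{n}x_iT^{i-n}$. -}

module Defs where

open import Level using (Level; _⊔_) renaming (suc to lsuc)
open import Data.Nat as ℕ using (ℕ; zero; suc; _∸_; _^_)
open import Data.Nat.Combinatorics using (_C_)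
open import Data.Fin using (Fin)
open import Data.Product using (∃)
open import Relation.Nullary using (¬_; yes; no)
open import Relation.Binary.PropositionalEquality using (_≡_)
open import Algebra.Bundles using (CommutativeRing)

record FiniteField (q : ℕ) (c ℓ : Level) : Set (lsuc (c ⊔ ℓ)) where
  field
    commRing : CommutativeRing c ℓ
  open CommutativeRing commRing using (Carrier; _≈_; _*_; 0#; 1#)
  field
    1≉0      : ¬ (1# ≈ 0#)
    inverse  : ∀ x → ¬ (x ≈ 0#) → ∃ λ y → x * y ≈ 1#
    enum     : Fin q → Carrier
    enum-surj : ∀ x → ∃ λ i → enum i ≈ x
    enum-inj  : ∀ i j → enum i ≈ enum j → i ≡ j

module PowerSeries {c ℓ : Level} (R : CommutativeRing c ℓ) where
  open CommutativeRing R

  PS : Set c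
  PS = ℕ → Carrier

  _≋_ : PS → PS → Set ℓ
  f ≋ g = ∀ n → f n ≈ g n

  sumR : ℕ → (ℕ → Carrier) → Carrier
  sumR zero    h = 0#
  sumR (suc n) h = sumR n h + h n

  natR : ℕ → Carrier
  natR zero    = 0#
  natR (suc n) = 1# + natR n

  zeroPS : PS
  zeroPS _ = 0#

  onePS : PS
  onePS zero    = 1#
  onePS (suc _) = 0#

  _⊕_ : PS → PS → PS
  (f ⊕ g) n = f n + g n

  _⊛_ : PS → PS → PS
  (f ⊛ g) n = sumR (suc n) (λ i → f i * g (n ∸ i))

  scale : Carrier → PS → PS
  scale a f n = a * f n

  _^PS_ : PS → ℕ → PS
  f ^PS zero    = onePS
  f ^PS (suc k) = f ⊛ (f ^PS k)

  T : PS
  T zero          = 0#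
  T (suc zero)    = 1#
  T (suc (suc _)) = 0#

  negPS : PS → PS
  negPS f n = - f n

  sumPS : ℕ → (ℕ → PS) → PS
  sumPS zero    F = zeroPS
  sumPS (suc n) F = sumPS n F ⊕ F n

  Δ : (q r m : ℕ) → PS → PS
  Δ q r m x n = x (n ℕ.* q ^ m ℕ.+ r)

  D : ℕ → PS → PS
  D n x j = natR ((j ℕ.+ n) C n) * x (j ℕ.+ n)

{-# OPTIONS --safe #-}
module Submission where

-- Write Q = q^m, a power of the characteristic p. By the Frobenius identity and Fermat's little
-- theorem in F_q, (Σ y_n T^n)^Q = Σ y_n^Q T^(nQ) = Σ y_n T^(nQ), so the left-hand side has
-- coefficient x_(dQ+r) at T^(dQ) and 0 at all other powers of T. On the right-hand side the
-- coefficient of T^N is x_(N+r) times C(N+r,r) Σ_{j<Q-r} (-1)^j C(N,j), and for N > 0 the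
-- alternating sum telescopes to (-1)^J C(N-1,J) with J = Q-1-r. The congruences
-- C(dQ+a,b) ≡ C(a,b) for b < Q and C(Q-1,j) ≡ (-1)^j, both read off from (1+T)^Q = 1 + T^Q,
-- show that this factor is 1 when Q divides N and 0 otherwise.

open import Data.Nat as ℕ using (ℕ; zero; suc; _∸_; _≤_; _<_; z≤n; s≤s; _≤?_; _≟_; NonZero)
import Data.Nat.Properties as ℕ
open import Data.Nat.Combinatorics using (_C_; nCk+nC[k+1]≡[n+1]C[k+1]; k>n⇒nCk≡0; nCn≡1; nC1≡n; k![n∸k]!∣n!)
open import Data.Nat.Combinatorics.Specification using (nCk≡n!/k![n-k]!)
open import Data.Nat.Divisibility using (_∣_; divides; ∣⇒≤; m∣m*n)
open import Data.Nat.DivMod using (_/_; _%_; m/n*n≡m; [m+kn]%n≡m%n; m*n%n≡0; m<n⇒m%n≡m; m≡m%n+[m/n]*n; m%n<n)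
open import Data.Nat.Primality using (Prime; euclidsLemma; prime⇒nonZero)
open import Data.Nat.Solver using (module +-*-Solver)
open import Data.Fin as Fin using (Fin; toℕ; fromℕ; inject₁)
import Data.Fin.Properties as Fin
open import Data.Fin.Permutation using (Permutation; permutation)
open import Data.Product using (∃; _,_; proj₁; proj₂)
open import Data.Sum using (inj₁; inj₂)
open import Data.Empty using (⊥-elim)
open import Function using (_∘_)
open import Function.Bundles using (Inverse)
open import Relation.Nullary using (Dec; yes; no; ¬_)
open import Relation.Binary.PropositionalEquality as ≡ using (_≡_; _≢_)
open import Relation.Binary.Structures using (IsEquivalence)
open import Algebra.Bundles using (CommutativeRing; CommutativeSemiring; CommutativeMonoid)
open import Algebra.Structures using (IsCommutativeMonoid)
import Algebra.Structures.Biased as Biased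
import Algebra.Properties.Monoid.Mult as MonoidMult
import Algebra.Properties.CommutativeMonoid.Sum as CommutativeMonoidSum
import Algebra.Properties.CommutativeSemigroup as CommutativeSemigroupProperties
open import Defs

module _ where
  open import Data.Nat using (_+_; _*_; _!)
  open import Data.Nat.Properties using (_!≢0; _!*_!≢0)
  open ≡ using (refl; cong; cong₂; sym; trans; subst; module ≡-Reasoning)
  open ≡-Reasoning
  open +-*-Solver

  [1+k]*[1+n]C[1+k]≡[1+n]*nCk : ∀ n k → suc k * (suc n C suc k) ≡ suc n * (n C k)
  [1+k]*[1+n]C[1+k]≡[1+n]*nCk zero    zero    = refl
  [1+k]*[1+n]C[1+k]≡[1+n]*nCk zero    (suc k) = begin
    suc (suc k) * (1 C suc (suc k)) ≡⟨ cong (suc (suc k) *_) (k>n⇒nCk≡0 {1} {suc (suc k)} (s≤s (s≤s z≤n))) ⟩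
    suc (suc k) * 0                 ≡⟨ ℕ.*-zeroʳ (suc (suc k)) ⟩
    0                               ≡⟨ cong (1 *_) (k>n⇒nCk≡0 {0} {suc k} (s≤s z≤n)) ⟨
    1 * (0 C suc k)                 ∎
  [1+k]*[1+n]C[1+k]≡[1+n]*nCk (suc n) zero    = begin
    1 * (suc (suc n) C 1) ≡⟨ ℕ.*-identityˡ _ ⟩
    suc (suc n) C 1       ≡⟨ nC1≡n (suc (suc n)) ⟩
    suc (suc n)           ≡⟨ ℕ.*-identityʳ (suc (suc n)) ⟨
    suc (suc n) * 1       ∎
  [1+k]*[1+n]C[1+k]≡[1+n]*nCk (suc n) (suc k) = begin
    (2 + k) * (suc (suc n) C suc (suc k)) ≡⟨ cong ((2 + k) *_) (nCk+nC[k+1]≡[n+1]C[k+1] (suc n) (suc k)) ⟨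
    (2 + k) * (a + b)                     ≡⟨ solve 3 (λ k a b → (con 2 :+ k) :* (a :+ b) := (con 1 :+ k) :* a :+ a :+ (con 2 :+ k) :* b) refl k a b ⟩
    (1 + k) * a + a + (2 + k) * b         ≡⟨ cong₂ (λ u v → u + a + v) ([1+k]*[1+n]C[1+k]≡[1+n]*nCk n k) ([1+k]*[1+n]C[1+k]≡[1+n]*nCk n (suc k)) ⟩
    (1 + n) * c + a + (1 + n) * d         ≡⟨ solve 4 (λ n a c d → (con 1 :+ n) :* c :+ a :+ (con 1 :+ n) :* d := (con 1 :+ n) :* (c :+ d) :+ a) refl n a c d ⟩
    (1 + n) * (c + d) + a                 ≡⟨ cong (λ u → (1 + n) * u + a) (nCk+nC[k+1]≡[n+1]C[k+1] n k) ⟩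
    (1 + n) * a + a                       ≡⟨ solve 2 (λ n a → (con 1 :+ n) :* a :+ a := (con 2 :+ n) :* a) refl n a ⟩
    (2 + n) * a                           ∎
    where
    a = suc n C suc k
    b = suc n C suc (suc k)
    c = n C k
    d = n C suc k

  p∣pCk : ∀ {p k} → Prime p → 0 < k → k < p → p ∣ p C k
  p∣pCk {suc n} {suc k} p-prime _ k<p
    with euclidsLemma (suc k) (suc n C suc k) p-prime
           (subst (suc n ∣_) (sym ([1+k]*[1+n]C[1+k]≡[1+n]*nCk n k)) (m∣m*n (n C k)))
  ... | inj₁ p∣1+k = ⊥-elim (ℕ.<⇒≱ k<p (∣⇒≤ p∣1+k))
  ... | inj₂ p∣pCk = p∣pCk

  [k+l]Ck*k!*l!≡[k+l]! : ∀ k l → ((k + l) C k) * (k ! * l !) ≡ (k + l) !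
  [k+l]Ck*k!*l!≡[k+l]! k l = begin
    ((k + l) C k) * (k ! * l !)                                 ≡⟨ cong (λ t → ((k + l) C k) * (k ! * t !)) (ℕ.m+n∸m≡n k l) ⟨
    ((k + l) C k) * (k ! * (k + l ∸ k) !)                       ≡⟨ cong (_* (k ! * (k + l ∸ k) !)) (nCk≡n!/k![n-k]! k≤k+l) ⟩
    ((k + l) ! / (k ! * (k + l ∸ k) !)) * (k ! * (k + l ∸ k) !) ≡⟨ m/n*n≡m (k![n∸k]!∣n! k≤k+l) ⟩
    (k + l) !                                                   ∎
    where
    k≤k+l = ℕ.m≤m+n k l
    instance _ = k !* (k + l ∸ k) !≢0

  [a+b]Ca*[a+b+c]C[a+b]≡[a+b+c]Ca*[b+c]Cb : ∀ a b c →
    ((a + b) C a) * ((a + b + c) C (a + b)) ≡ ((a + b + c) C a) * ((b + c) C b)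
  [a+b]Ca*[a+b+c]C[a+b]≡[a+b+c]Ca*[b+c]Cb a b c =
    ℕ.*-cancelʳ-≡ _ _ (a ! * (b ! * c !)) {{ℕ.m*n≢0 _ _ {{a !≢0}} {{b !* c !≢0}}}} (begin
      (X * Y) * (a ! * (b ! * c !))           ≡⟨ solve 5 (λ X Y A B C′ → (X :* Y) :* (A :* (B :* C′)) := Y :* ((X :* (A :* B)) :* C′)) refl X Y (a !) (b !) (c !) ⟩
      Y * ((X * (a ! * b !)) * c !)           ≡⟨ cong (λ t → Y * (t * c !)) ([k+l]Ck*k!*l!≡[k+l]! a b) ⟩
      Y * ((a + b) ! * c !)                   ≡⟨ [k+l]Ck*k!*l!≡[k+l]! (a + b) c ⟩
      (a + b + c) !                           ≡⟨ cong _! (ℕ.+-assoc a b c) ⟩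
      (a + (b + c)) !                         ≡⟨ [k+l]Ck*k!*l!≡[k+l]! a (b + c) ⟨
      ((a + (b + c)) C a) * (a ! * (b + c) !) ≡⟨ cong₂ (λ t u → (t C a) * (a ! * u)) (ℕ.+-assoc a b c) ([k+l]Ck*k!*l!≡[k+l]! b c) ⟨
      W * (a ! * (Z * (b ! * c !)))           ≡⟨ solve 5 (λ W Z A B C′ → W :* (A :* (Z :* (B :* C′))) := (W :* Z) :* (A :* (B :* C′))) refl W Z (a !) (b !) (c !) ⟩
      (W * Z) * (a ! * (b ! * c !))           ∎)
    where
    X = (a + b) C a
    Y = (a + b + c) C (a + b)
    Z = (b + c) C b
    W = (a + b + c) C a

  [r+j]Cr*[N+r]C[r+j]≡[N+r]Cr*NCj : ∀ {j N} r → j ≤ N → ((r + j) C r) * ((N + r) C (r + j)) ≡ ((N + r) C r) * (N C j)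
  [r+j]Cr*[N+r]C[r+j]≡[N+r]Cr*NCj {j} {N} r j≤N = begin
    ((r + j) C r) * ((N + r) C (r + j))           ≡⟨ cong (λ t → ((r + j) C r) * (t C (r + j))) r+j+[N∸j]≡N+r ⟨
    ((r + j) C r) * ((r + j + (N ∸ j)) C (r + j)) ≡⟨ [a+b]Ca*[a+b+c]C[a+b]≡[a+b+c]Ca*[b+c]Cb r j (N ∸ j) ⟩
    ((r + j + (N ∸ j)) C r) * ((j + (N ∸ j)) C j) ≡⟨ cong₂ (λ t u → (t C r) * (u C j)) r+j+[N∸j]≡N+r (ℕ.m+[n∸m]≡n j≤N) ⟩
    ((N + r) C r) * (N C j)                       ∎
    where
    r+j+[N∸j]≡N+r : r + j + (N ∸ j) ≡ N + r
    r+j+[N∸j]≡N+r = trans (ℕ.+-assoc r j (N ∸ j)) (trans (cong (r +_) (ℕ.m+[n∸m]≡n j≤N)) (ℕ.+-comm r N))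

  N∸j+[r+j]≡N+r : ∀ {j N} r → j ≤ N → N ∸ j + (r + j) ≡ N + r
  N∸j+[r+j]≡N+r {j} {N} r j≤N = begin
    N ∸ j + (r + j) ≡⟨ cong (N ∸ j +_) (ℕ.+-comm r j) ⟩
    N ∸ j + (j + r) ≡⟨ ℕ.+-assoc (N ∸ j) j r ⟨
    N ∸ j + j + r   ≡⟨ cong (_+ r) (ℕ.m∸n+n≡m j≤N) ⟩
    N + r           ∎

  m+kn≢jn : ∀ {m n} .{{_ : NonZero n}} → 0 < m → m < n → ∀ k j → m + k * n ≢ j * n
  m+kn≢jn {m} {n} 0<m m<n k j m+kn≡jn = ℕ.<⇒≢ 0<m (begin
    0               ≡⟨ m*n%n≡0 j n ⟨
    j * n % n       ≡⟨ cong (_% n) m+kn≡jn ⟨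
    (m + k * n) % n ≡⟨ [m+kn]%n≡m%n m k n ⟩
    m % n           ≡⟨ m<n⇒m%n≡m m<n ⟩
    m               ∎)

  s+dQ+r≡[1+d]Q+[s+r∸Q] : ∀ {s r Q} → Q ≤ s + r → ∀ d → s + d * Q + r ≡ suc d * Q + (s + r ∸ Q)
  s+dQ+r≡[1+d]Q+[s+r∸Q] {s} {r} {Q} Q≤s+r d = begin
    s + d * Q + r           ≡⟨ solve 3 (λ s r dQ → s :+ dQ :+ r := (s :+ r) :+ dQ) refl s r (d * Q) ⟩
    (s + r) + d * Q         ≡⟨ cong (_+ d * Q) (ℕ.m+[n∸m]≡n Q≤s+r) ⟨
    Q + (s + r ∸ Q) + d * Q ≡⟨ solve 3 (λ Q t dQ → Q :+ t :+ dQ := Q :+ dQ :+ t) refl Q (s + r ∸ Q) (d * Q) ⟩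
    suc d * Q + (s + r ∸ Q) ∎

  s+r∸Q<r : ∀ {s r Q} → Q ≤ s + r → s < Q → s + r ∸ Q < r
  s+r∸Q<r {s} {r} {Q} Q≤s+r s<Q = subst (s + r ∸ Q <_) (ℕ.m+n∸m≡n Q r) (ℕ.∸-monoˡ-< (ℕ.+-monoˡ-< r s<Q) Q≤s+r)

module Frobenius {a ℓ} (S : CommutativeSemiring a ℓ) where
  open CommutativeSemiring S
  open import Relation.Binary.Reasoning.Setoid setoid
  open import Algebra.Properties.Semiring.Exp semiring using (_^_; ^-congˡ; ^-assocʳ)
  open import Algebra.Properties.Semiring.Mult semiring using (_×_; ×-congʳ; ×-assocˡ; ×-assoc-*; ×-comm-*)
  open import Algebra.Properties.Monoid.Sum +-monoid using (sum; sum-cong-≋; sum-init-last; sum-replicate-zero)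
  import Algebra.Properties.CommutativeSemiring.Binomial S as Binomial

  sum-ends : ∀ {m} (t : Fin (suc (suc m)) → Carrier) → (∀ k → t (Fin.suc (inject₁ k)) ≈ 0#) →
             sum t ≈ t Fin.zero + t (fromℕ (suc m))
  sum-ends {m} t middle = +-congˡ (begin
    sum (λ k → t (Fin.suc k))                                        ≈⟨ sum-init-last (λ k → t (Fin.suc k)) ⟩
    sum (λ k → t (Fin.suc (inject₁ k))) + t (fromℕ (suc m))          ≈⟨ +-congʳ (sum-cong-≋ middle) ⟩
    sum {m} (λ _ → 0#) + t (fromℕ (suc m))                           ≈⟨ +-congʳ (sum-replicate-zero m) ⟩
    0# + t (fromℕ (suc m))                                           ≈⟨ +-identityˡ _ ⟩
    t (fromℕ (suc m))                                                ∎)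

  ×-multiple-of-char : ∀ {p n} → p × 1# ≈ 0# → ∀ x → p ∣ n → n × x ≈ 0#
  ×-multiple-of-char {p} char-p x (divides t ≡.refl) = begin
    (t ℕ.* p) × x      ≈⟨ ×-assocˡ x t p ⟨
    t × (p × x)        ≈⟨ ×-congʳ t (trans (×-assoc-* p 1# x) (×-congʳ p (*-identityˡ x))) ⟨
    t × ((p × 1#) * x) ≈⟨ ×-congʳ t (*-congʳ char-p) ⟩
    t × (0# * x)       ≈⟨ ×-comm-* t 0# x ⟨
    0# * (t × x)       ≈⟨ zeroˡ _ ⟩
    0#                 ∎

  frobenius : ∀ {p} → Prime p → p × 1# ≈ 0# → ∀ x y → (x + y) ^ p ≈ x ^ p + y ^ p
  frobenius {suc m} p-prime char-p x y = begin
    (x + y) ^ suc m                               ≈⟨ Binomial.theorem (suc m) x y ⟩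
    Binomial.binomialExpansion x y (suc m)        ≈⟨ sum-ends (Binomial.binomialTerm x y (suc m)) middle ⟩
    (1 × (1# * y ^ suc m)) + lastTerm (toℕ (fromℕ (suc m))) ≈⟨ +-cong (trans (+-identityʳ _) (*-identityˡ _)) (lastTerm≈ _ (Fin.toℕ-fromℕ (suc m))) ⟩
    y ^ suc m + x ^ suc m                         ≈⟨ +-comm _ _ ⟩
    x ^ suc m + y ^ suc m                         ∎
    where
    -- The last index of the expansion is fromℕ p, whose toℕ is p only propositionally.
    lastTerm : ℕ → Carrier
    lastTerm j = (suc m C j) × (x ^ j * y ^ (suc m ∸ j))
    lastTerm≈ : ∀ j → j ≡ suc m → lastTerm j ≈ x ^ suc m
    lastTerm≈ j ≡.refl rewrite nCn≡1 (suc m) | ℕ.n∸n≡0 m = trans (+-identityʳ _) (*-identityʳ _)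
    middle : ∀ k → Binomial.binomialTerm x y (suc m) (Fin.suc (inject₁ k)) ≈ 0#
    middle k = ×-multiple-of-char char-p _ (p∣pCk p-prime (s≤s z≤n)
      (s≤s (≡.subst (_< m) (≡.sym (Fin.toℕ-inject₁ k)) (Fin.toℕ<n k))))

  frobenius-^ : ∀ {p} → Prime p → p × 1# ≈ 0# →
                ∀ E x y → (x + y) ^ (p ℕ.^ E) ≈ x ^ (p ℕ.^ E) + y ^ (p ℕ.^ E)
  frobenius-^ p-prime char-p zero x y = trans (*-identityʳ _) (+-cong (sym (*-identityʳ x)) (sym (*-identityʳ y)))
  frobenius-^ {p} p-prime char-p (suc E) x y = begin
    (x + y) ^ (p ℕ.* p ℕ.^ E)                     ≈⟨ ^-assocʳ (x + y) p (p ℕ.^ E) ⟨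
    ((x + y) ^ p) ^ (p ℕ.^ E)                     ≈⟨ ^-congˡ (p ℕ.^ E) (frobenius p-prime char-p x y) ⟩
    (x ^ p + y ^ p) ^ (p ℕ.^ E)                   ≈⟨ frobenius-^ p-prime char-p E (x ^ p) (y ^ p) ⟩
    (x ^ p) ^ (p ℕ.^ E) + (y ^ p) ^ (p ℕ.^ E)     ≈⟨ +-cong (^-assocʳ x p (p ℕ.^ E)) (^-assocʳ y p (p ℕ.^ E)) ⟩
    x ^ (p ℕ.* p ℕ.^ E) + y ^ (p ℕ.* p ℕ.^ E)     ∎

module PowerSeriesProperties {c ℓ} (R : CommutativeRing c ℓ) where
  open CommutativeRing R
  open PowerSeries R
  open import Relation.Binary.Reasoning.Setoid setoid
  open import Algebra.Properties.Ring ring using (-1*x≈-x; -‿involutive; -‿distribˡ-*; -0#≈0#)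

  when : ∀ {P : Set} → Dec P → Carrier → Carrier
  when (yes _) x = x
  when (no _)  x = 0#

  when-yes : ∀ {P : Set} (d : Dec P) x → P → when d x ≈ x
  when-yes (yes _) x _ = refl
  when-yes (no ¬p) x p = ⊥-elim (¬p p)

  when-no : ∀ {P : Set} (d : Dec P) x → ¬ P → when d x ≈ 0#
  when-no (yes p) x ¬p = ⊥-elim (¬p p)
  when-no (no _)  x _  = refl

  when-cong : ∀ {P : Set} (d : Dec P) {x y} → x ≈ y → when d x ≈ when d y
  when-cong (yes _) x≈y = x≈y
  when-cong (no _)  _   = refl

  sumR-cong-length : ∀ {m n} h → m ≡ n → sumR m h ≈ sumR n h
  sumR-cong-length h ≡.refl = refl

  sumR-cong< : ∀ n {h g} → (∀ i → i < n → h i ≈ g i) → sumR n h ≈ sumR n g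
  sumR-cong< zero    h≈g = refl
  sumR-cong< (suc n) h≈g = +-cong (sumR-cong< n (λ i i<n → h≈g i (ℕ.m<n⇒m<1+n i<n))) (h≈g n (ℕ.n<1+n n))

  sumR-cong : ∀ n {h g} → (∀ i → h i ≈ g i) → sumR n h ≈ sumR n g
  sumR-cong n h≈g = sumR-cong< n (λ i _ → h≈g i)

  sumR-zero : ∀ n {h} → (∀ i → i < n → h i ≈ 0#) → sumR n h ≈ 0#
  sumR-zero zero    h≈0 = refl
  sumR-zero (suc n) h≈0 =
    trans (+-cong (sumR-zero n (λ i i<n → h≈0 i (ℕ.m<n⇒m<1+n i<n))) (h≈0 n (ℕ.n<1+n n))) (+-identityˡ 0#)

  sumR-distrib-+ : ∀ n h g → sumR n (λ i → h i + g i) ≈ sumR n h + sumR n g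
  sumR-distrib-+ zero    h g = sym (+-identityˡ 0#)
  sumR-distrib-+ (suc n) h g = trans (+-congʳ (sumR-distrib-+ n h g)) (interchange _ _ _ _)
    where open CommutativeSemigroupProperties +-commutativeSemigroup using (interchange)

  *-distribˡ-sumR : ∀ n a h → a * sumR n h ≈ sumR n (λ i → a * h i)
  *-distribˡ-sumR zero    a h = zeroʳ a
  *-distribˡ-sumR (suc n) a h = trans (distribˡ a _ _) (+-congʳ (*-distribˡ-sumR n a h))

  *-distribʳ-sumR : ∀ n a h → sumR n h * a ≈ sumR n (λ i → h i * a)
  *-distribʳ-sumR n a h = trans (*-comm _ a) (trans (*-distribˡ-sumR n a h) (sumR-cong n (λ i → *-comm a (h i))))

  sumR-split : ∀ m n h → sumR (m ℕ.+ n) h ≈ sumR m h + sumR n (λ j → h (m ℕ.+ j))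
  sumR-split m zero    h = trans (sumR-cong-length h (ℕ.+-identityʳ m)) (sym (+-identityʳ _))
  sumR-split m (suc n) h = begin
    sumR (m ℕ.+ suc n) h                                  ≈⟨ sumR-cong-length h (ℕ.+-suc m n) ⟩
    sumR (m ℕ.+ n) h + h (m ℕ.+ n)                        ≈⟨ +-congʳ (sumR-split m n h) ⟩
    (sumR m h + sumR n (λ j → h (m ℕ.+ j))) + h (m ℕ.+ n) ≈⟨ +-assoc _ _ _ ⟩
    sumR m h + sumR (suc n) (λ j → h (m ℕ.+ j))           ∎

  sumR-head : ∀ n h → sumR (suc n) h ≈ h 0 + sumR n (λ i → h (suc i))
  sumR-head n h = trans (sumR-split 1 n h) (+-congʳ (+-identityˡ (h 0)))

  sumR-reverse : ∀ n h → sumR n h ≈ sumR n (λ i → h (n ∸ suc i))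
  sumR-reverse zero    h = refl
  sumR-reverse (suc n) h = begin
    sumR n h + h n                     ≈⟨ +-congʳ (sumR-reverse n h) ⟩
    sumR n (λ i → h (n ∸ suc i)) + h n ≈⟨ +-comm _ _ ⟩
    h n + sumR n (λ i → h (n ∸ suc i)) ≈⟨ sumR-head n (λ i → h (n ∸ i)) ⟨
    sumR (suc n) (λ i → h (n ∸ i))     ∎

  sumR-comm : ∀ m n (F : ℕ → ℕ → Carrier) →
              sumR m (λ i → sumR n (λ j → F i j)) ≈ sumR n (λ j → sumR m (λ i → F i j))
  sumR-comm zero    n F = sym (sumR-zero n (λ _ _ → refl))
  sumR-comm (suc m) n F = trans (+-congʳ (sumR-comm m n F)) (sym (sumR-distrib-+ n _ _))

  sumR-single : ∀ n k {h} → k < n → (∀ i → i < n → i ≢ k → h i ≈ 0#) → sumR n h ≈ h k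
  sumR-single (suc n) k {h} k<1+n others with k ≟ n
  ... | yes ≡.refl = trans (+-congʳ (sumR-zero n (λ i i<n → others i (ℕ.m<n⇒m<1+n i<n) (ℕ.<⇒≢ i<n)))) (+-identityˡ _)
  ... | no k≢n = trans (+-cong (sumR-single n k (ℕ.≤∧≢⇒< (ℕ.≤-pred k<1+n) k≢n) (λ i i<n → others i (ℕ.m<n⇒m<1+n i<n)))
                               (others n (ℕ.n<1+n n) (k≢n ∘ ≡.sym)))
                       (+-identityʳ _)

  sumR-truncate : ∀ {m} n {h} → m ≤ n → (∀ i → m ≤ i → i < n → h i ≈ 0#) → sumR n h ≈ sumR m h
  sumR-truncate {m} n {h} m≤n tail≈0 = begin
    sumR n h                                              ≈⟨ sumR-cong-length h (ℕ.m+[n∸m]≡n m≤n) ⟨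
    sumR (m ℕ.+ (n ∸ m)) h                                ≈⟨ sumR-split m (n ∸ m) h ⟩
    sumR m h + sumR (n ∸ m) (λ j → h (m ℕ.+ j))           ≈⟨ +-congˡ (sumR-zero (n ∸ m) (λ j j<n∸m →
                                                               tail≈0 _ (ℕ.m≤m+n m j) (≡.subst (_ <_) (ℕ.m+[n∸m]≡n m≤n) (ℕ.+-monoʳ-< m j<n∸m)))) ⟩
    sumR m h + 0#                                         ≈⟨ +-identityʳ _ ⟩
    sumR m h                                              ∎

  natR-+ : ∀ m n → natR (m ℕ.+ n) ≈ natR m + natR n
  natR-+ zero    n = sym (+-identityˡ _)
  natR-+ (suc m) n = trans (+-congˡ (natR-+ m n)) (sym (+-assoc _ _ _))

  natR-* : ∀ m n → natR (m ℕ.* n) ≈ natR m * natR n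
  natR-* zero    n = sym (zeroˡ _)
  natR-* (suc m) n = begin
    natR (n ℕ.+ m ℕ.* n)            ≈⟨ natR-+ n (m ℕ.* n) ⟩
    natR n + natR (m ℕ.* n)         ≈⟨ +-cong (sym (*-identityˡ _)) (natR-* m n) ⟩
    1# * natR n + natR m * natR n   ≈⟨ distribʳ _ _ _ ⟨
    (1# + natR m) * natR n          ∎

  ≋-isEquivalence : IsEquivalence _≋_
  ≋-isEquivalence = record
    { refl  = λ n → refl
    ; sym   = λ f≋g n → sym (f≋g n)
    ; trans = λ f≋g g≋h n → trans (f≋g n) (g≋h n)
    }

  open IsEquivalence ≋-isEquivalence public
    using () renaming (refl to ≋-refl; sym to ≋-sym; trans to ≋-trans)

  ⊕-cong : ∀ {f f′ g g′} → f ≋ f′ → g ≋ g′ → (f ⊕ g) ≋ (f′ ⊕ g′)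
  ⊕-cong f≋f′ g≋g′ n = +-cong (f≋f′ n) (g≋g′ n)

  ⊛-cong : ∀ {f f′ g g′} → f ≋ f′ → g ≋ g′ → (f ⊛ g) ≋ (f′ ⊛ g′)
  ⊛-cong f≋f′ g≋g′ n = sumR-cong (suc n) (λ i → *-cong (f≋f′ i) (g≋g′ (n ∸ i)))

  ⊛-comm : ∀ f g → (f ⊛ g) ≋ (g ⊛ f)
  ⊛-comm f g n = trans (sumR-reverse (suc n) _) (sumR-cong< (suc n) (λ i i<1+n →
    trans (*-comm _ _) (*-congʳ (reflexive (≡.cong g (ℕ.m∸[m∸n]≡n (ℕ.≤-pred i<1+n)))))))

  ⊛-identityˡ : ∀ f → (onePS ⊛ f) ≋ f
  ⊛-identityˡ f n = trans (sumR-head n _)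
    (trans (+-cong (*-identityˡ (f n)) (sumR-zero n (λ i _ → zeroˡ _))) (+-identityʳ _))

  ⊛-zeroˡ : ∀ f → (zeroPS ⊛ f) ≋ zeroPS
  ⊛-zeroˡ f n = sumR-zero (suc n) (λ i _ → zeroˡ _)

  ⊛-distribʳ : ∀ f g h → ((g ⊕ h) ⊛ f) ≋ ((g ⊛ f) ⊕ (h ⊛ f))
  ⊛-distribʳ f g h n = trans (sumR-cong (suc n) (λ i → distribʳ _ _ _)) (sumR-distrib-+ (suc n) _ _)

  -- Both sides equal the sum of [i ≤ k] F i k over the square i, k ≤ n.
  sumR-triangle : ∀ n (F : ℕ → ℕ → Carrier) →
    sumR (suc n) (λ k → sumR (suc k) (λ i → F i k)) ≈ sumR (suc n) (λ i → sumR (suc (n ∸ i)) (λ j → F i (i ℕ.+ j)))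
  sumR-triangle n F = begin
    sumR (suc n) (λ k → sumR (suc k) (λ i → F i k))
      ≈⟨ sumR-cong< (suc n) (λ k k<1+n → column k (ℕ.≤-pred k<1+n)) ⟩
    sumR (suc n) (λ k → sumR (suc n) (λ i → G i k))
      ≈⟨ sumR-comm (suc n) (suc n) G ⟨
    sumR (suc n) (λ i → sumR (suc n) (λ k → G i k))
      ≈⟨ sumR-cong< (suc n) (λ i i<1+n → row i (ℕ.≤-pred i<1+n)) ⟩
    sumR (suc n) (λ i → sumR (suc (n ∸ i)) (λ j → F i (i ℕ.+ j))) ∎
    where
    G : ℕ → ℕ → Carrier
    G i k = when (i ≤? k) (F i k)
    column : ∀ k → k ≤ n → sumR (suc k) (λ i → F i k) ≈ sumR (suc n) (λ i → G i k)
    column k k≤n = sym (trans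
      (sumR-truncate (suc n) (s≤s k≤n) (λ i k<i _ → when-no (i ≤? k) _ (ℕ.<⇒≱ k<i)))
      (sumR-cong< (suc k) (λ i i<1+k → when-yes (i ≤? k) _ (ℕ.≤-pred i<1+k))))
    row : ∀ i → i ≤ n → sumR (suc n) (λ k → G i k) ≈ sumR (suc (n ∸ i)) (λ j → F i (i ℕ.+ j))
    row i i≤n = begin
      sumR (suc n) (λ k → G i k)
        ≈⟨ sumR-cong-length _ (≡.trans (ℕ.+-suc i (n ∸ i)) (≡.cong suc (ℕ.m+[n∸m]≡n i≤n))) ⟨
      sumR (i ℕ.+ suc (n ∸ i)) (λ k → G i k)
        ≈⟨ sumR-split i (suc (n ∸ i)) _ ⟩
      sumR i (λ k → G i k) + sumR (suc (n ∸ i)) (λ j → G i (i ℕ.+ j))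
        ≈⟨ +-cong (sumR-zero i (λ k k<i → when-no (i ≤? k) _ (ℕ.<⇒≱ k<i)))
                  (sumR-cong (suc (n ∸ i)) (λ j → when-yes (i ≤? i ℕ.+ j) _ (ℕ.m≤m+n i j))) ⟩
      0# + sumR (suc (n ∸ i)) (λ j → F i (i ℕ.+ j))
        ≈⟨ +-identityˡ _ ⟩
      sumR (suc (n ∸ i)) (λ j → F i (i ℕ.+ j)) ∎

  ⊛-assoc : ∀ f g h → ((f ⊛ g) ⊛ h) ≋ (f ⊛ (g ⊛ h))
  ⊛-assoc f g h n = begin
    sumR (suc n) (λ k → sumR (suc k) (λ i → f i * g (k ∸ i)) * h (n ∸ k))
      ≈⟨ sumR-cong (suc n) (λ k → *-distribʳ-sumR (suc k) _ _) ⟩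
    sumR (suc n) (λ k → sumR (suc k) (λ i → (f i * g (k ∸ i)) * h (n ∸ k)))
      ≈⟨ sumR-triangle n (λ i k → (f i * g (k ∸ i)) * h (n ∸ k)) ⟩
    sumR (suc n) (λ i → sumR (suc (n ∸ i)) (λ j → (f i * g (i ℕ.+ j ∸ i)) * h (n ∸ (i ℕ.+ j))))
      ≈⟨ sumR-cong (suc n) (λ i → sumR-cong (suc (n ∸ i)) (λ j → trans (*-assoc _ _ _)
           (*-congˡ (*-cong (reflexive (≡.cong g (ℕ.m+n∸m≡n i j))) (reflexive (≡.cong h (≡.sym (ℕ.∸-+-assoc n i j)))))))) ⟩
    sumR (suc n) (λ i → sumR (suc (n ∸ i)) (λ j → f i * (g j * h (n ∸ i ∸ j))))
      ≈⟨ sumR-cong (suc n) (λ i → *-distribˡ-sumR (suc (n ∸ i)) _ _) ⟨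
    sumR (suc n) (λ i → f i * sumR (suc (n ∸ i)) (λ j → g j * h (n ∸ i ∸ j))) ∎

  ⊕-isCommutativeMonoid : IsCommutativeMonoid _≋_ _⊕_ zeroPS
  ⊕-isCommutativeMonoid = record
    { isMonoid = record
      { isSemigroup = record
        { isMagma = record { isEquivalence = ≋-isEquivalence ; ∙-cong = ⊕-cong }
        ; assoc   = λ f g h n → +-assoc (f n) (g n) (h n) }
      ; identity = (λ f n → +-identityˡ (f n)) , (λ f n → +-identityʳ (f n)) }
    ; comm = λ f g n → +-comm (f n) (g n) }

  ⊛-isCommutativeMonoid : IsCommutativeMonoid _≋_ _⊛_ onePS
  ⊛-isCommutativeMonoid = record
    { isMonoid = record
      { isSemigroup = record
        { isMagma = record { isEquivalence = ≋-isEquivalence ; ∙-cong = ⊛-cong }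
        ; assoc   = ⊛-assoc }
      ; identity = ⊛-identityˡ , (λ f → ≋-trans (⊛-comm f onePS) (⊛-identityˡ f)) }
    ; comm = ⊛-comm }

  PS-commutativeSemiring : CommutativeSemiring c ℓ
  PS-commutativeSemiring = record
    { Carrier = PS ; _≈_ = _≋_ ; _+_ = _⊕_ ; _*_ = _⊛_ ; 0# = zeroPS ; 1# = onePS
    ; isCommutativeSemiring = Biased.isCommutativeSemiringˡ (record
       { +-isCommutativeMonoid = ⊕-isCommutativeMonoid
       ; *-isCommutativeMonoid = ⊛-isCommutativeMonoid
       ; distribʳ = ⊛-distribʳ
       ; zeroˡ    = ⊛-zeroˡ }) }

  module PS = CommutativeSemiring PS-commutativeSemiring
  open import Algebra.Properties.Semiring.Exp semiring public using () renaming (_^_ to _^R_)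
  open import Algebra.Properties.Semiring.Exp PS.semiring using ()
    renaming (_^_ to _^ₛ_; ^-congˡ to ^ₛ-congˡ; ^-congʳ to ^ₛ-congʳ; ^-assocʳ to ^ₛ-assocʳ; ^-homo-* to ^ₛ-homo-⊛)
  open import Algebra.Properties.CommutativeSemiring.Exp PS-commutativeSemiring using ()
    renaming (^-distrib-* to ^ₛ-distrib-⊛)
  open import Algebra.Properties.Semiring.Mult PS.semiring using () renaming (_×_ to _×ₛ_)

  ^PS≡^ₛ : ∀ f n → f ^PS n ≡ f ^ₛ n
  ^PS≡^ₛ f zero    = ≡.refl
  ^PS≡^ₛ f (suc n) = ≡.cong (f ⊛_) (^PS≡^ₛ f n)

  ×ₛ-coefficient : ∀ n f i → (n ×ₛ f) i ≈ natR n * f i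
  ×ₛ-coefficient zero    f i = sym (zeroˡ _)
  ×ₛ-coefficient (suc n) f i = trans (+-cong (sym (*-identityˡ _)) (×ₛ-coefficient n f i)) (sym (distribʳ _ _ _))

  sumPS-coefficient : ∀ n F i → sumPS n F i ≈ sumR n (λ k → F k i)
  sumPS-coefficient zero    F i = refl
  sumPS-coefficient (suc n) F i = +-congʳ (sumPS-coefficient n F i)

  sumPS-cong : ∀ n {F G} → (∀ k → F k ≋ G k) → sumPS n F ≋ sumPS n G
  sumPS-cong zero    F≋G = ≋-refl
  sumPS-cong (suc n) F≋G = ⊕-cong (sumPS-cong n F≋G) (F≋G n)

  monomial : Carrier → ℕ → PS
  monomial a n i = when (i ≟ n) a

  monomial-cong : ∀ {a b} n → a ≈ b → monomial a n ≋ monomial b n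
  monomial-cong n a≈b i = when-cong (i ≟ n) a≈b

  monomial-⊛ : ∀ a M g i → (monomial a M ⊛ g) i ≈ when (M ≤? i) (a * g (i ∸ M))
  monomial-⊛ a M g i with M ≤? i
  ... | yes M≤i = trans (sumR-single (suc i) M (s≤s M≤i) (λ j _ j≢M → trans (*-congʳ (when-no (j ≟ M) a j≢M)) (zeroˡ _)))
                        (*-congʳ (when-yes (M ≟ M) a ≡.refl))
  ... | no M≰i = sumR-zero (suc i) (λ j j<1+i →
                   trans (*-congʳ (when-no (j ≟ M) a (λ { ≡.refl → M≰i (ℕ.≤-pred j<1+i) }))) (zeroˡ _))

  monomial-⊛-monomial : ∀ a M b N → (monomial a M ⊛ monomial b N) ≋ monomial (a * b) (M ℕ.+ N)
  monomial-⊛-monomial a M b N i = trans (monomial-⊛ a M (monomial b N) i) (coefficient (M ≤? i) (i ≟ M ℕ.+ N))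
    where
    coefficient : (d : Dec (M ≤ i)) (e : Dec (i ≡ M ℕ.+ N)) → when d (a * when (i ∸ M ≟ N) b) ≈ when e (a * b)
    coefficient (yes M≤i) (yes ≡.refl) = *-congˡ (when-yes (M ℕ.+ N ∸ M ≟ N) b (ℕ.m+n∸m≡n M N))
    coefficient (yes M≤i) (no i≢M+N)   = trans (*-congˡ (when-no (i ∸ M ≟ N) b
      (λ i∸M≡N → i≢M+N (≡.trans (≡.sym (ℕ.m+[n∸m]≡n M≤i)) (≡.cong (M ℕ.+_) i∸M≡N))))) (zeroʳ _)
    coefficient (no M≰i)  (yes ≡.refl) = ⊥-elim (M≰i (ℕ.m≤m+n M N))
    coefficient (no M≰i)  (no _)       = refl

  monomial-^ : ∀ a n k → (monomial a n ^ₛ k) ≋ monomial (a ^R k) (n ℕ.* k)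
  monomial-^ a n zero i with i ≟ n ℕ.* 0
  ... | yes i≡n*0 = reflexive (≡.cong onePS (≡.trans i≡n*0 (ℕ.*-zeroʳ n)))
  ... | no i≢n*0 with i
  ...   | zero  = ⊥-elim (i≢n*0 (≡.sym (ℕ.*-zeroʳ n)))
  ...   | suc _ = refl
  monomial-^ a n (suc k) = ≋-trans (⊛-cong (≋-refl {monomial a n}) (monomial-^ a n k))
    (≋-trans (monomial-⊛-monomial a n (a ^R k) (n ℕ.* k))
      (λ i → reflexive (≡.cong (λ t → when (i ≟ t) (a * (a ^R k))) (≡.sym (ℕ.*-suc n k)))))

  split-at : ∀ N y → y ≋ (sumPS (suc N) (λ n → monomial (y n) n) ⊕ (monomial 1# (suc N) ⊛ (λ i → y (suc N ℕ.+ i))))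
  split-at N y i = sym (begin
    sumPS (suc N) (λ n → monomial (y n) n) i + (monomial 1# (suc N) ⊛ (λ j → y (suc N ℕ.+ j))) i
      ≈⟨ +-cong (sumPS-coefficient (suc N) _ i) (monomial-⊛ 1# (suc N) (λ j → y (suc N ℕ.+ j)) i) ⟩
    sumR (suc N) (λ n → when (i ≟ n) (y n)) + when (suc N ≤? i) (1# * y (suc N ℕ.+ (i ∸ suc N)))
      ≈⟨ by-cases (i ≤? N) ⟩
    y i ∎)
    where
    by-cases : Dec (i ≤ N) → sumR (suc N) (λ n → when (i ≟ n) (y n)) + when (suc N ≤? i) (1# * y (suc N ℕ.+ (i ∸ suc N))) ≈ y i
    by-cases (yes i≤N) = trans
      (+-cong (sumR-single (suc N) i (s≤s i≤N) (λ n _ n≢i → when-no (i ≟ n) _ (n≢i ∘ ≡.sym))) (when-no (suc N ≤? i) _ (ℕ.≤⇒≯ i≤N)))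
      (trans (+-congʳ (when-yes (i ≟ i) _ ≡.refl)) (+-identityʳ _))
    by-cases (no i≰N) = trans
      (+-cong (sumR-zero (suc N) (λ n n<1+N → when-no (i ≟ n) _ (λ { ≡.refl → i≰N (ℕ.≤-pred n<1+N) })))
              (when-yes (suc N ≤? i) _ (ℕ.≰⇒> i≰N)))
      (trans (+-identityˡ _) (trans (*-identityˡ _) (reflexive (≡.cong y (ℕ.m+[n∸m]≡n (ℕ.≰⇒> i≰N))))))

  -- z(T^Q) = Σ z_n T^(nQ)
  inflate : ℕ → PS → PS
  inflate Q z N = sumR (suc N) (λ n → when (N ≟ n ℕ.* Q) (z n))

  inflate-cong : ∀ Q {z z′} → z ≋ z′ → inflate Q z ≋ inflate Q z′
  inflate-cong Q z≋z′ N = sumR-cong (suc N) (λ n → when-cong (N ≟ n ℕ.* Q) (z≋z′ n))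

  inflate-multiple : ∀ Q .{{_ : ℕ.NonZero Q}} z d → inflate Q z (d ℕ.* Q) ≈ z d
  inflate-multiple Q z d = trans
    (sumR-single (suc (d ℕ.* Q)) d (s≤s (ℕ.m≤m*n d Q))
      (λ n _ n≢d → when-no (d ℕ.* Q ≟ n ℕ.* Q) _ (λ dQ≡nQ → n≢d (≡.sym (ℕ.*-cancelʳ-≡ d n Q dQ≡nQ)))))
    (when-yes (d ℕ.* Q ≟ d ℕ.* Q) _ ≡.refl)

  inflate-nonmultiple : ∀ Q .{{_ : ℕ.NonZero Q}} z s d → 0 < s → s < Q → inflate Q z (s ℕ.+ d ℕ.* Q) ≈ 0#
  inflate-nonmultiple Q z s d 0<s s<Q =
    sumR-zero (suc (s ℕ.+ d ℕ.* Q)) (λ n _ → when-no (s ℕ.+ d ℕ.* Q ≟ n ℕ.* Q) (z n) (m+kn≢jn 0<s s<Q d n))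

  IsOneModT^ : ℕ → PS → Set ℓ
  IsOneModT^ Q v = ∀ i → i < Q → v i ≈ onePS i

  ⊛-oneModT^ : ∀ {Q v} g {b} → IsOneModT^ Q v → b < Q → (v ⊛ g) b ≈ g b
  ⊛-oneModT^ {Q} {v} g {b} v≡1 b<Q = trans
    (sumR-single (suc b) 0 (s≤s z≤n) (λ i i<1+b i≢0 → trans (*-congʳ (v≡1 i (ℕ.≤-<-trans (ℕ.≤-pred i<1+b) b<Q))) (higher i i≢0)))
    (trans (*-congʳ (v≡1 0 (ℕ.≤-<-trans z≤n b<Q))) (*-identityˡ _))
    where
    higher : ∀ i → i ≢ 0 → onePS i * g (b ∸ i) ≈ 0#
    higher zero    i≢0 = ⊥-elim (i≢0 ≡.refl)
    higher (suc i) _   = zeroˡ _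

  1+T : PS
  1+T = onePS ⊕ monomial 1# 1

  [1+T]^-coefficient : ∀ n i → (1+T ^ₛ n) i ≈ natR (n C i)
  [1+T]^-coefficient zero    zero    = sym (+-identityʳ 1#)
  [1+T]^-coefficient zero    (suc i) = refl
  [1+T]^-coefficient (suc n) i = begin
    (1+T ^ₛ suc n) i                                                 ≈⟨ ⊛-distribʳ (1+T ^ₛ n) onePS (monomial 1# 1) i ⟩
    (onePS ⊛ (1+T ^ₛ n)) i + (monomial 1# 1 ⊛ (1+T ^ₛ n)) i          ≈⟨ +-cong (⊛-identityˡ (1+T ^ₛ n) i) (monomial-⊛ 1# 1 (1+T ^ₛ n) i) ⟩
    (1+T ^ₛ n) i + when (1 ≤? i) (1# * (1+T ^ₛ n) (i ∸ 1))           ≈⟨ pascal i ⟩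
    natR (suc n C i)                                                 ∎
    where
    pascal : ∀ i → (1+T ^ₛ n) i + when (1 ≤? i) (1# * (1+T ^ₛ n) (i ∸ 1)) ≈ natR (suc n C i)
    pascal zero    = trans (+-identityʳ _) ([1+T]^-coefficient n 0)
    pascal (suc i) = begin
      (1+T ^ₛ n) (suc i) + when (1 ≤? suc i) (1# * (1+T ^ₛ n) i)     ≈⟨ +-cong ([1+T]^-coefficient n (suc i))
                                                                         (trans (*-identityˡ _) ([1+T]^-coefficient n i)) ⟩
      natR (n C suc i) + natR (n C i)                                ≈⟨ +-comm _ _ ⟩
      natR (n C i) + natR (n C suc i)                                ≈⟨ natR-+ (n C i) (n C suc i) ⟨
      natR (n C i ℕ.+ n C suc i)                                     ≈⟨ reflexive (≡.cong natR (nCk+nC[k+1]≡[n+1]C[k+1] n i)) ⟩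
      natR (suc n C suc i)                                           ∎

  -1# : Carrier
  -1# = - 1#

  -1^suc : ∀ j → -1# ^R suc j ≈ - (-1# ^R j)
  -1^suc j = -1*x≈-x _

  -1^*-1^ : ∀ j → -1# ^R j * -1# ^R j ≈ 1#
  -1^*-1^ zero    = *-identityˡ 1#
  -1^*-1^ (suc j) = begin
    (-1# * -1# ^R j) * (-1# * -1# ^R j)   ≈⟨ interchange -1# (-1# ^R j) -1# (-1# ^R j) ⟩
    (-1# * -1#) * (-1# ^R j * -1# ^R j)   ≈⟨ *-cong (trans (-1*x≈-x -1#) (-‿involutive 1#)) (-1^*-1^ j) ⟩
    1# * 1#                               ≈⟨ *-identityˡ 1# ⟩
    1#                                    ∎
    where open CommutativeSemigroupProperties *-commutativeSemigroup using (interchange)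

  alternating-sum-zero : ∀ J → sumR (suc J) (λ j → -1# ^R j * natR (0 C j)) ≈ 1#
  alternating-sum-zero zero    = trans (+-identityˡ _) (trans (*-identityˡ _) (+-identityʳ 1#))
  alternating-sum-zero (suc J) = trans (+-cong (alternating-sum-zero J) (zeroʳ _)) (+-identityʳ 1#)

  alternating-sum-suc : ∀ M J → sumR (suc J) (λ j → -1# ^R j * natR (suc M C j)) ≈ -1# ^R J * natR (M C J)
  alternating-sum-suc M zero    = +-identityˡ _
  alternating-sum-suc M (suc J) = begin
    sumR (suc J) (λ j → -1# ^R j * natR (suc M C j)) + s′ * natR (suc M C suc J) ≈⟨ +-congʳ (alternating-sum-suc M J) ⟩
    s * a + s′ * natR (suc M C suc J)       ≈⟨ +-congˡ (*-congˡ (reflexive (≡.cong natR (nCk+nC[k+1]≡[n+1]C[k+1] M J)))) ⟨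
    s * a + s′ * natR (M C J ℕ.+ M C suc J) ≈⟨ +-congˡ (*-congˡ (natR-+ (M C J) (M C suc J))) ⟩
    s * a + s′ * (a + b)                    ≈⟨ +-congˡ (distribˡ _ _ _) ⟩
    s * a + (s′ * a + s′ * b)               ≈⟨ +-congˡ (+-congʳ (trans (*-congʳ (-1^suc J)) (sym (-‿distribˡ-* _ _)))) ⟩
    s * a + (- (s * a) + s′ * b)            ≈⟨ +-assoc _ _ _ ⟨
    (s * a + - (s * a)) + s′ * b            ≈⟨ +-congʳ (-‿inverseʳ _) ⟩
    0# + s′ * b                             ≈⟨ +-identityˡ _ ⟩
    s′ * b                                  ∎
    where
    s = -1# ^R J
    s′ = -1# ^R suc J
    a = natR (M C J)
    b = natR (M C suc J)

  -T^ : ∀ j → (negPS T ^PS j) ≋ monomial (-1# ^R j) j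
  -T^ j = ≡.subst (λ f → f ≋ monomial (-1# ^R j) j) (≡.sym (^PS≡^ₛ (negPS T) j))
    (≋-trans (^ₛ-congˡ j -T≋-1#T) (≋-trans (monomial-^ -1# 1 j)
      (λ i → reflexive (≡.cong (λ n → when (i ≟ n) (-1# ^R j)) (ℕ.*-identityˡ j)))))
    where
    -T≋-1#T : negPS T ≋ monomial -1# 1
    -T≋-1#T zero          = -0#≈0#
    -T≋-1#T (suc zero)    = refl
    -T≋-1#T (suc (suc i)) = -0#≈0#

  hasseTerm : ℕ → PS → ℕ → PS
  hasseTerm r x j = scale (natR ((r ℕ.+ j) C r)) ((negPS T ^PS j) ⊛ D (r ℕ.+ j) x)

  hasseTerm-coefficient : ∀ r x j N →
    hasseTerm r x j N ≈ natR ((N ℕ.+ r) C r) * (-1# ^R j * natR (N C j)) * x (N ℕ.+ r)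
  hasseTerm-coefficient r x j N = begin
    a * ((negPS T ^PS j) ⊛ D (r ℕ.+ j) x) N                    ≈⟨ *-congˡ (⊛-cong (-T^ j) (≋-refl {D (r ℕ.+ j) x}) N) ⟩
    a * (monomial (-1# ^R j) j ⊛ D (r ℕ.+ j) x) N              ≈⟨ *-congˡ (monomial-⊛ (-1# ^R j) j (D (r ℕ.+ j) x) N) ⟩
    a * when (j ≤? N) (-1# ^R j * D (r ℕ.+ j) x (N ∸ j))       ≈⟨ by-cases (j ≤? N) ⟩
    natR ((N ℕ.+ r) C r) * (-1# ^R j * natR (N C j)) * x (N ℕ.+ r) ∎
    where
    a = natR ((r ℕ.+ j) C r)
    by-cases : (d : Dec (j ≤ N)) → a * when d (-1# ^R j * D (r ℕ.+ j) x (N ∸ j))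
                                   ≈ natR ((N ℕ.+ r) C r) * (-1# ^R j * natR (N C j)) * x (N ℕ.+ r)
    by-cases (no j≰N) = begin
      a * 0#                                                         ≈⟨ zeroʳ a ⟩
      0#                                                             ≈⟨ zeroˡ _ ⟨
      0# * x (N ℕ.+ r)                                               ≈⟨ *-congʳ (trans (*-congˡ (*-congˡ NCj≈0)) (trans (*-congˡ (zeroʳ _)) (zeroʳ _))) ⟨
      natR ((N ℕ.+ r) C r) * (-1# ^R j * natR (N C j)) * x (N ℕ.+ r) ∎
      where NCj≈0 = reflexive (≡.cong natR (k>n⇒nCk≡0 (ℕ.≰⇒> j≰N)))
    by-cases (yes j≤N) = begin
      a * (s * (natR ((N ∸ j ℕ.+ (r ℕ.+ j)) C (r ℕ.+ j)) * x (N ∸ j ℕ.+ (r ℕ.+ j))))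
        ≈⟨ reflexive (≡.cong (λ t → a * (s * (natR (t C (r ℕ.+ j)) * x t))) (N∸j+[r+j]≡N+r r j≤N)) ⟩
      a * (s * (natR ((N ℕ.+ r) C (r ℕ.+ j)) * x (N ℕ.+ r)))   ≈⟨ trans (*-congˡ (sym (*-assoc _ _ _))) (sym (*-assoc _ _ _)) ⟩
      (a * (s * natR ((N ℕ.+ r) C (r ℕ.+ j)))) * x (N ℕ.+ r)   ≈⟨ *-congʳ (x∙yz≈y∙xz _ _ _) ⟩
      (s * (a * natR ((N ℕ.+ r) C (r ℕ.+ j)))) * x (N ℕ.+ r)   ≈⟨ *-congʳ (*-congˡ (trans (sym (natR-* ((r ℕ.+ j) C r) _)) (trans
                                                                    (reflexive (≡.cong natR ([r+j]Cr*[N+r]C[r+j]≡[N+r]Cr*NCj r j≤N)))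
                                                                    (natR-* ((N ℕ.+ r) C r) (N C j))))) ⟩
      (s * (natR ((N ℕ.+ r) C r) * natR (N C j))) * x (N ℕ.+ r) ≈⟨ *-congʳ (x∙yz≈y∙xz _ _ _) ⟩
      natR ((N ℕ.+ r) C r) * (s * natR (N C j)) * x (N ℕ.+ r)   ∎
      where
      s = -1# ^R j
      open CommutativeSemigroupProperties *-commutativeSemigroup using (x∙yz≈y∙xz)

  sumPS-hasseTerm : ∀ L r x N →
    sumPS L (hasseTerm r x) N ≈ natR ((N ℕ.+ r) C r) * sumR L (λ j → -1# ^R j * natR (N C j)) * x (N ℕ.+ r)
  sumPS-hasseTerm L r x N = begin
    sumPS L (hasseTerm r x) N                                              ≈⟨ sumPS-coefficient L (hasseTerm r x) N ⟩
    sumR L (λ j → hasseTerm r x j N)                                        ≈⟨ sumR-cong L (λ j → hasseTerm-coefficient r x j N) ⟩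
    sumR L (λ j → natR ((N ℕ.+ r) C r) * (-1# ^R j * natR (N C j)) * x (N ℕ.+ r)) ≈⟨ *-distribʳ-sumR L _ _ ⟨
    sumR L (λ j → natR ((N ℕ.+ r) C r) * (-1# ^R j * natR (N C j))) * x (N ℕ.+ r) ≈⟨ *-congʳ (*-distribˡ-sumR L _ _) ⟨
    natR ((N ℕ.+ r) C r) * sumR L (λ j → -1# ^R j * natR (N C j)) * x (N ℕ.+ r) ∎

  sumPS-hasseTerm-single : ∀ r x → sumPS 1 (hasseTerm r x) ≋ D r x
  sumPS-hasseTerm-single r x N = begin
    0# + natR ((r ℕ.+ 0) C r) * (onePS ⊛ D (r ℕ.+ 0) x) N    ≈⟨ +-identityˡ _ ⟩
    natR ((r ℕ.+ 0) C r) * (onePS ⊛ D (r ℕ.+ 0) x) N         ≈⟨ reflexive (≡.cong (λ t → natR (t C r) * (onePS ⊛ D t x) N) (ℕ.+-identityʳ r)) ⟩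
    natR (r C r) * (onePS ⊛ D r x) N                         ≈⟨ *-cong (reflexive (≡.cong natR (nCn≡1 r))) (⊛-identityˡ (D r x) N) ⟩
    (1# + 0#) * D r x N                                      ≈⟨ trans (*-congʳ (+-identityʳ 1#)) (*-identityˡ _) ⟩
    D r x N                                                  ∎

  module _ {p} (p-prime : Prime p) (char-p : natR p ≈ 0#) where
    open Frobenius PS-commutativeSemiring using (frobenius-^)
    private instance
      p≢0 = prime⇒nonZero p-prime

    ⊕-frobenius : ∀ E f g → ((f ⊕ g) ^ₛ (p ℕ.^ E)) ≋ ((f ^ₛ (p ℕ.^ E)) ⊕ (g ^ₛ (p ℕ.^ E)))
    ⊕-frobenius = frobenius-^ p-prime (λ i → trans (×ₛ-coefficient p onePS i) (trans (*-congʳ char-p) (zeroˡ _)))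

    sumPS-frobenius : ∀ E n F → (sumPS n F ^ₛ (p ℕ.^ E)) ≋ sumPS n (λ k → F k ^ₛ (p ℕ.^ E))
    sumPS-frobenius E zero    F with p ℕ.^ E | ℕ.m^n>0 p E
    ... | suc Q | _ = ⊛-zeroˡ (zeroPS ^ₛ Q)
    sumPS-frobenius E (suc n) F = ≋-trans (⊕-frobenius E (sumPS n F) (F n)) (⊕-cong (sumPS-frobenius E n F) ≋-refl)

    ^-frobenius : ∀ E y → (y ^ₛ (p ℕ.^ E)) ≋ inflate (p ℕ.^ E) (λ n → y n ^R (p ℕ.^ E))
    ^-frobenius E y N = begin
      (y ^ₛ Q) N                                           ≈⟨ ^ₛ-congˡ Q (split-at N y) N ⟩
      ((head ⊕ tail) ^ₛ Q) N                               ≈⟨ ⊕-frobenius E head tail N ⟩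
      (head ^ₛ Q) N + (tail ^ₛ Q) N                        ≈⟨ +-cong (sumPS-frobenius E (suc N) _ N) tail^Q≈0 ⟩
      sumPS (suc N) (λ n → monomial (y n) n ^ₛ Q) N + 0#   ≈⟨ +-identityʳ _ ⟩
      sumPS (suc N) (λ n → monomial (y n) n ^ₛ Q) N        ≈⟨ sumPS-cong (suc N) (λ n → monomial-^ (y n) n Q) N ⟩
      sumPS (suc N) (λ n → monomial (y n ^R Q) (n ℕ.* Q)) N ≈⟨ sumPS-coefficient (suc N) _ N ⟩
      inflate Q (λ n → y n ^R Q) N                         ∎
      where
      Q = p ℕ.^ E
      head = sumPS (suc N) (λ n → monomial (y n) n)
      rest : PS
      rest i = y (suc N ℕ.+ i)
      tail = monomial 1# (suc N) ⊛ rest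
      tail^Q≈0 : (tail ^ₛ Q) N ≈ 0#
      tail^Q≈0 = begin
        (tail ^ₛ Q) N                                      ≈⟨ ^ₛ-distrib-⊛ (monomial 1# (suc N)) rest Q N ⟩
        ((monomial 1# (suc N) ^ₛ Q) ⊛ (rest ^ₛ Q)) N         ≈⟨ ⊛-cong (monomial-^ 1# (suc N) Q) (≋-refl {rest ^ₛ Q}) N ⟩
        (monomial (1# ^R Q) (suc N ℕ.* Q) ⊛ (rest ^ₛ Q)) N ≈⟨ monomial-⊛ _ (suc N ℕ.* Q) (rest ^ₛ Q) N ⟩
        when (suc N ℕ.* Q ≤? N) _                          ≈⟨ when-no (suc N ℕ.* Q ≤? N) _ (ℕ.<⇒≱ (ℕ.m≤m*n (suc N) Q {{ℕ.m^n≢0 p E}})) ⟩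
        0#                                                 ∎

  module PowerOfCharacteristic
    {p} (p-prime : Prime p) (char-p : natR p ≈ 0#) {Q} (E : ℕ) (Q≡p^E : Q ≡ p ℕ.^ E) where

    private
      module R^ = MonoidMult *-monoid
      module PS^ = MonoidMult PS.*-monoid

    instance
      Q≢0 : ℕ.NonZero Q
      Q≢0 = ≡.subst ℕ.NonZero (≡.sym Q≡p^E) (ℕ.m^n≢0 p E {{prime⇒nonZero p-prime}})

    ⊕-frobenius-Q : ∀ f g → ((f ⊕ g) ^ₛ Q) ≋ ((f ^ₛ Q) ⊕ (g ^ₛ Q))
    ⊕-frobenius-Q rewrite Q≡p^E = ⊕-frobenius p-prime char-p E

    ^-frobenius-Q : ∀ y → (y ^ₛ Q) ≋ inflate Q (λ n → y n ^R Q)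
    ^-frobenius-Q rewrite Q≡p^E = ^-frobenius p-prime char-p E

    [1+T]^Q : (1+T ^ₛ Q) ≋ (onePS ⊕ monomial 1# Q)
    [1+T]^Q = ≋-trans (⊕-frobenius-Q onePS (monomial 1# 1)) (⊕-cong (PS^.×-idem (PS.*-identityˡ onePS) Q)
      (≋-trans (monomial-^ 1# 1 Q) (≋-trans (monomial-cong (1 ℕ.* Q) (R^.×-idem (*-identityˡ 1#) Q))
        (λ i → reflexive (≡.cong (λ n → when (i ≟ n) 1#) (ℕ.*-identityˡ Q))))))

    QCi≈0 : ∀ i → 0 < i → i < Q → natR (Q C i) ≈ 0#
    QCi≈0 (suc i) _ i<Q = begin
      natR (Q C suc i)                          ≈⟨ [1+T]^-coefficient Q (suc i) ⟨
      (1+T ^ₛ Q) (suc i)                        ≈⟨ [1+T]^Q (suc i) ⟩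
      0# + when (suc i ≟ Q) 1#                  ≈⟨ +-identityˡ _ ⟩
      when (suc i ≟ Q) 1#                       ≈⟨ when-no (suc i ≟ Q) 1# (ℕ.<⇒≢ i<Q) ⟩
      0#                                        ∎

    [1+T^Q]^-oneModT^Q : ∀ n → IsOneModT^ Q ((onePS ⊕ monomial 1# Q) ^ₛ n)
    [1+T^Q]^-oneModT^Q zero    i _   = refl
    [1+T^Q]^-oneModT^Q (suc n) i i<Q = begin
      ((onePS ⊕ monomial 1# Q) ⊛ V) i                 ≈⟨ ⊛-distribʳ V onePS (monomial 1# Q) i ⟩
      (onePS ⊛ V) i + (monomial 1# Q ⊛ V) i           ≈⟨ +-cong (⊛-identityˡ V i) (monomial-⊛ 1# Q V i) ⟩
      V i + when (Q ≤? i) (1# * V (i ∸ Q))             ≈⟨ +-cong ([1+T^Q]^-oneModT^Q n i i<Q) (when-no (Q ≤? i) _ (ℕ.<⇒≱ i<Q)) ⟩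
      onePS i + 0#                                    ≈⟨ +-identityʳ _ ⟩
      onePS i                                         ∎
      where V = (onePS ⊕ monomial 1# Q) ^ₛ n

    [nQ+a]Cb≈aCb : ∀ n a b → b < Q → natR ((n ℕ.* Q ℕ.+ a) C b) ≈ natR (a C b)
    [nQ+a]Cb≈aCb n a b b<Q = begin
      natR ((n ℕ.* Q ℕ.+ a) C b)                         ≈⟨ [1+T]^-coefficient (n ℕ.* Q ℕ.+ a) b ⟨
      (1+T ^ₛ (n ℕ.* Q ℕ.+ a)) b                         ≈⟨ ^ₛ-homo-⊛ 1+T (n ℕ.* Q) a b ⟩
      ((1+T ^ₛ (n ℕ.* Q)) ⊛ (1+T ^ₛ a)) b                ≈⟨ ⊛-cong [1+T]^nQ (≋-refl {1+T ^ₛ a}) b ⟩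
      (((onePS ⊕ monomial 1# Q) ^ₛ n) ⊛ (1+T ^ₛ a)) b    ≈⟨ ⊛-oneModT^ (1+T ^ₛ a) ([1+T^Q]^-oneModT^Q n) b<Q ⟩
      (1+T ^ₛ a) b                                       ≈⟨ [1+T]^-coefficient a b ⟩
      natR (a C b)                                       ∎
      where
      [1+T]^nQ : (1+T ^ₛ (n ℕ.* Q)) ≋ ((onePS ⊕ monomial 1# Q) ^ₛ n)
      [1+T]^nQ = ≋-trans (^ₛ-congʳ 1+T (ℕ.*-comm n Q)) (≋-trans (≋-sym (^ₛ-assocʳ 1+T Q n)) (^ₛ-congˡ n [1+T]^Q))

    [Q∸1]Cj≈-1^j : ∀ j → j < Q → natR ((Q ∸ 1) C j) ≈ -1# ^R j
    [Q∸1]Cj≈-1^j zero    _     = +-identityʳ 1#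
    [Q∸1]Cj≈-1^j (suc j) 1+j<Q = begin
      b                                 ≈⟨ +-identityˡ _ ⟨
      0# + b                            ≈⟨ +-congʳ (-‿inverseˡ a) ⟨
      (- a + a) + b                     ≈⟨ +-assoc _ _ _ ⟩
      - a + (a + b)                     ≈⟨ +-congˡ (natR-+ ((Q ∸ 1) C j) ((Q ∸ 1) C suc j)) ⟨
      - a + natR ((Q ∸ 1) C j ℕ.+ (Q ∸ 1) C suc j) ≈⟨ +-congˡ (reflexive (≡.cong natR (≡.trans (nCk+nC[k+1]≡[n+1]C[k+1] (Q ∸ 1) j)
                                                     (≡.cong (_C suc j) (ℕ.suc-pred Q))))) ⟩
      - a + natR (Q C suc j)            ≈⟨ +-congˡ (QCi≈0 (suc j) (s≤s z≤n) 1+j<Q) ⟩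
      - a + 0#                          ≈⟨ +-identityʳ _ ⟩
      - a                               ≈⟨ -‿cong ([Q∸1]Cj≈-1^j j (ℕ.<-trans (ℕ.n<1+n j) 1+j<Q)) ⟩
      - (-1# ^R j)                      ≈⟨ -1^suc j ⟨
      -1# ^R suc j                      ∎
      where
      a = natR ((Q ∸ 1) C j)
      b = natR ((Q ∸ 1) C suc j)

    weight : ℕ → ℕ → Carrier
    weight r N = natR ((N ℕ.+ r) C r) * sumR (Q ∸ r) (λ j → -1# ^R j * natR (N C j))

    module _ {r} (r<Q : r < Q) where
      private
        J = Q ∸ suc r
        Q∸r≡1+J : Q ∸ r ≡ suc J
        Q∸r≡1+J = ℕ.+-∸-assoc 1 r<Q
        1+J+r≡Q : suc J ℕ.+ r ≡ Q
        1+J+r≡Q = ≡.trans (≡.sym (ℕ.+-suc J r)) (ℕ.m∸n+n≡m r<Q)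
        J<Q : J < Q
        J<Q = ≡.subst (J <_) 1+J+r≡Q (ℕ.m≤m+n (suc J) r)

      weight-zero : weight r 0 ≈ 1#
      weight-zero = begin
        natR (r C r) * sumR (Q ∸ r) (λ j → -1# ^R j * natR (0 C j))   ≈⟨ *-cong (reflexive (≡.cong natR (nCn≡1 r))) (sumR-cong-length _ Q∸r≡1+J) ⟩
        (1# + 0#) * sumR (suc J) (λ j → -1# ^R j * natR (0 C j))      ≈⟨ *-cong (+-identityʳ 1#) (alternating-sum-zero J) ⟩
        1# * 1#                                                       ≈⟨ *-identityˡ 1# ⟩
        1#                                                            ∎

      weight-suc : ∀ M → weight r (suc M) ≈ natR ((suc M ℕ.+ r) C r) * (-1# ^R J * natR (M C J))
      weight-suc M = *-congˡ (trans (sumR-cong-length _ Q∸r≡1+J) (alternating-sum-suc M J))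

      weight-multiple : ∀ d → weight r (d ℕ.* Q) ≈ 1#
      weight-multiple zero    = weight-zero
      weight-multiple (suc d) = begin
        weight r (suc d ℕ.* Q)                                         ≈⟨ reflexive (≡.cong (weight r) [1+d]Q≡1+M) ⟩
        weight r (suc M)                                               ≈⟨ weight-suc M ⟩
        natR ((suc M ℕ.+ r) C r) * (-1# ^R J * natR (M C J))           ≈⟨ *-cong [1+M+r]Cr≈1 (*-congˡ MCJ≈-1^J) ⟩
        1# * (-1# ^R J * -1# ^R J)                                     ≈⟨ trans (*-identityˡ _) (-1^*-1^ J) ⟩
        1#                                                             ∎
        where
        M = Q ∸ 1 ℕ.+ d ℕ.* Q
        [1+d]Q≡1+M : suc d ℕ.* Q ≡ suc M
        [1+d]Q≡1+M = ≡.cong (ℕ._+ d ℕ.* Q) (≡.sym (ℕ.suc-pred Q))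
        [1+M+r]Cr≈1 : natR ((suc M ℕ.+ r) C r) ≈ 1#
        [1+M+r]Cr≈1 = begin
          natR ((suc M ℕ.+ r) C r)         ≈⟨ reflexive (≡.cong (λ t → natR ((t ℕ.+ r) C r)) [1+d]Q≡1+M) ⟨
          natR ((suc d ℕ.* Q ℕ.+ r) C r)   ≈⟨ [nQ+a]Cb≈aCb (suc d) r r r<Q ⟩
          natR (r C r)                     ≈⟨ reflexive (≡.cong natR (nCn≡1 r)) ⟩
          1# + 0#                          ≈⟨ +-identityʳ 1# ⟩
          1#                               ∎
        MCJ≈-1^J : natR (M C J) ≈ -1# ^R J
        MCJ≈-1^J = begin
          natR (M C J)                       ≈⟨ reflexive (≡.cong (λ t → natR (t C J)) (ℕ.+-comm (Q ∸ 1) (d ℕ.* Q))) ⟩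
          natR ((d ℕ.* Q ℕ.+ (Q ∸ 1)) C J)   ≈⟨ [nQ+a]Cb≈aCb d (Q ∸ 1) J J<Q ⟩
          natR ((Q ∸ 1) C J)                 ≈⟨ [Q∸1]Cj≈-1^j J J<Q ⟩
          -1# ^R J                           ∎

      -- Either C(s-1,J) vanishes, or s + r ≥ Q and then C(s+dQ+r,r) ≡ C(s+r-Q,r) = 0 since s+r-Q < r.
      weight-nonmultiple : ∀ s d → 0 < s → s < Q → weight r (s ℕ.+ d ℕ.* Q) ≈ 0#
      weight-nonmultiple (suc s) d _ 1+s<Q = begin
        weight r (suc s ℕ.+ d ℕ.* Q)                                          ≈⟨ weight-suc (s ℕ.+ d ℕ.* Q) ⟩
        natR ((suc s ℕ.+ d ℕ.* Q ℕ.+ r) C r) * (-1# ^R J * natR ((s ℕ.+ d ℕ.* Q) C J)) ≈⟨ *-congˡ (*-congˡ [s+dQ]CJ≈sCJ) ⟩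
        natR ((suc s ℕ.+ d ℕ.* Q ℕ.+ r) C r) * (-1# ^R J * natR (s C J))       ≈⟨ by-cases (s ℕ.<? J) ⟩
        0#                                                                     ∎
        where
        [s+dQ]CJ≈sCJ : natR ((s ℕ.+ d ℕ.* Q) C J) ≈ natR (s C J)
        [s+dQ]CJ≈sCJ = trans (reflexive (≡.cong (λ t → natR (t C J)) (ℕ.+-comm s (d ℕ.* Q)))) ([nQ+a]Cb≈aCb d s J J<Q)
        by-cases : Dec (s < J) → natR ((suc s ℕ.+ d ℕ.* Q ℕ.+ r) C r) * (-1# ^R J * natR (s C J)) ≈ 0#
        by-cases (yes s<J) = trans (*-congˡ (trans (*-congˡ (reflexive (≡.cong natR (k>n⇒nCk≡0 s<J)))) (zeroʳ _))) (zeroʳ _)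
        by-cases (no s≮J)  = trans (*-congʳ [1+s+dQ+r]Cr≈0) (zeroˡ _)
          where
          Q≤1+s+r : Q ≤ suc s ℕ.+ r
          Q≤1+s+r = ≡.subst (_≤ suc s ℕ.+ r) 1+J+r≡Q (ℕ.+-monoˡ-≤ r (s≤s (ℕ.≮⇒≥ s≮J)))
          [1+s+dQ+r]Cr≈0 : natR ((suc s ℕ.+ d ℕ.* Q ℕ.+ r) C r) ≈ 0#
          [1+s+dQ+r]Cr≈0 = begin
            natR ((suc s ℕ.+ d ℕ.* Q ℕ.+ r) C r)                     ≈⟨ reflexive (≡.cong (λ t → natR (t C r)) (s+dQ+r≡[1+d]Q+[s+r∸Q] {suc s} Q≤1+s+r d)) ⟩
            natR ((suc d ℕ.* Q ℕ.+ (suc s ℕ.+ r ∸ Q)) C r)           ≈⟨ [nQ+a]Cb≈aCb (suc d) _ r r<Q ⟩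
            natR ((suc s ℕ.+ r ∸ Q) C r)                             ≈⟨ reflexive (≡.cong natR (k>n⇒nCk≡0 (s+r∸Q<r {suc s} Q≤1+s+r 1+s<Q))) ⟩
            0#                                                       ∎

      inflate≈weight : ∀ (x : PS) N → inflate Q (λ n → x (n ℕ.* Q ℕ.+ r)) N ≈ weight r N * x (N ℕ.+ r)
      inflate≈weight x N = ≡.subst P (≡.sym (m≡m%n+[m/n]*n N Q)) (by-cases (N % Q) (N / Q) (m%n<n N Q))
        where
        y : PS
        y n = x (n ℕ.* Q ℕ.+ r)
        P : ℕ → Set ℓ
        P N = inflate Q y N ≈ weight r N * x (N ℕ.+ r)
        by-cases : ∀ s d → s < Q → P (s ℕ.+ d ℕ.* Q)
        by-cases zero    d _ = begin
          inflate Q y (d ℕ.* Q)                 ≈⟨ inflate-multiple Q y d ⟩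
          x (d ℕ.* Q ℕ.+ r)                     ≈⟨ *-identityˡ _ ⟨
          1# * x (d ℕ.* Q ℕ.+ r)                ≈⟨ *-congʳ (weight-multiple d) ⟨
          weight r (d ℕ.* Q) * x (d ℕ.* Q ℕ.+ r) ∎
        by-cases s@(suc _) d s<Q = begin
          inflate Q y (s ℕ.+ d ℕ.* Q)           ≈⟨ inflate-nonmultiple Q y s d (s≤s z≤n) s<Q ⟩
          0#                                    ≈⟨ zeroˡ _ ⟨
          0# * x (s ℕ.+ d ℕ.* Q ℕ.+ r)          ≈⟨ *-congʳ (weight-nonmultiple s d (s≤s z≤n) s<Q) ⟨
          weight r (s ℕ.+ d ℕ.* Q) * x (s ℕ.+ d ℕ.* Q ℕ.+ r) ∎

      Δ-power : (∀ a → a ^R Q ≈ a) → ∀ (x : PS) → ((λ n → x (n ℕ.* Q ℕ.+ r)) ^PS Q) ≋ sumPS (Q ∸ r) (hasseTerm r x)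
      Δ-power fermat x N = begin
        (y ^PS Q) N                  ≈⟨ reflexive (≡.cong (λ f → f N) (^PS≡^ₛ y Q)) ⟩
        (y ^ₛ Q) N                   ≈⟨ ^-frobenius-Q y N ⟩
        inflate Q (λ n → y n ^R Q) N ≈⟨ inflate-cong Q (λ n → fermat (y n)) N ⟩
        inflate Q y N                ≈⟨ inflate≈weight x N ⟩
        weight r N * x (N ℕ.+ r)     ≈⟨ sumPS-hasseTerm (Q ∸ r) r x N ⟨
        sumPS (Q ∸ r) (hasseTerm r x) N ∎
        where
        y : PS
        y n = x (n ℕ.* Q ℕ.+ r)

    Δ-power-last : (∀ a → a ^R Q ≈ a) → ∀ (x : PS) → ((λ n → x (n ℕ.* Q ℕ.+ (Q ∸ 1))) ^PS Q) ≋ D (Q ∸ 1) x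
    Δ-power-last fermat x = ≋-trans (Δ-power Q∸1<Q fermat x)
      (≡.subst (λ L → sumPS L (hasseTerm (Q ∸ 1) x) ≋ D (Q ∸ 1) x) (≡.sym (ℕ.m∸[m∸n]≡n 1≤Q)) (sumPS-hasseTerm-single (Q ∸ 1) x))
      where
      1≤Q : 1 ≤ Q
      1≤Q = ℕ.>-nonZero⁻¹ Q
      Q∸1<Q : Q ∸ 1 < Q
      Q∸1<Q = ℕ.∸-monoʳ-< (s≤s z≤n) 1≤Q

module FiniteFieldProperties {q c ℓ} (F : FiniteField q c ℓ) where
  open FiniteField F
  open CommutativeRing commRing
  open PowerSeries commRing using (natR)
  open PowerSeriesProperties commRing using (_^R_; natR-*)
  open import Relation.Binary.Reasoning.Setoid setoid

  index : Carrier → Fin q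
  index x = proj₁ (enum-surj x)

  enum-index : ∀ x → enum (index x) ≈ x
  enum-index x = proj₂ (enum-surj x)

  _≈?_ : ∀ x y → Dec (x ≈ y)
  x ≈? y with index x Fin.≟ index y
  ... | yes ix≡iy = yes (trans (sym (enum-index x)) (trans (reflexive (≡.cong enum ix≡iy)) (enum-index y)))
  ... | no ix≢iy  = no (λ x≈y → ix≢iy (enum-inj _ _ (trans (enum-index x) (trans x≈y (sym (enum-index y))))))

  sum-reindex : (M : CommutativeMonoid c ℓ) (φ : Inverse setoid setoid) →
    let open CommutativeMonoid M using () renaming (Carrier to A; _≈_ to _≈ₘ_)
        open CommutativeMonoidSum M using (sum) in
    (G : Carrier → A) → (∀ {x y} → x ≈ y → G x ≈ₘ G y) →
    sum (λ i → G (Inverse.to φ (enum i))) ≈ₘ sum (λ i → G (enum i))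
  sum-reindex M φ G G-cong = M.sym (M.trans (sum-permute (λ i → G (enum i)) π)
    (sum-cong-≋ (λ i → G-cong (enum-index (to (enum i))))))
    where
    module M = CommutativeMonoid M
    open CommutativeMonoidSum M using (sum-permute; sum-cong-≋)
    open Inverse φ using (to; from; to-cong; from-cong; strictlyInverseˡ; strictlyInverseʳ)
    π : Permutation q q
    π = permutation (λ i → index (to (enum i))) (λ i → index (from (enum i)))
      (λ i → enum-inj _ _ (trans (enum-index _) (trans (to-cong (enum-index _)) (strictlyInverseˡ _))))
      (λ i → enum-inj _ _ (trans (enum-index _) (trans (from-cong (enum-index _)) (strictlyInverseʳ _))))

  open import Algebra.Properties.Ring ring using (+-identityʳ-unique)
  open import Algebra.Properties.Monoid.Mult +-monoid using (_×_)
  open import Algebra.Properties.Semiring.Exp semiring using (^-congˡ; ^-assocʳ)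
  open import Algebra.Properties.CommutativeSemiring.Exp commutativeSemiring using (^-distrib-*)
  private
    module +Sum = CommutativeMonoidSum +-commutativeMonoid
    module *Sum = CommutativeMonoidSum *-commutativeMonoid

  natR≈×1# : ∀ n → natR n ≈ n × 1#
  natR≈×1# zero    = refl
  natR≈×1# (suc n) = +-congˡ (natR≈×1# n)

  natR[q]≈0 : natR q ≈ 0#
  natR[q]≈0 = +-identityʳ-unique (Σ λ i → enum i) (natR q) (begin
    Σ (λ i → enum i) + natR q           ≈⟨ +-congˡ (natR≈×1# q) ⟩
    Σ (λ i → enum i) + q × 1#           ≈⟨ +-congˡ (+Sum.sum-replicate q) ⟨
    Σ (λ i → enum i) + Σ (λ _ → 1#)     ≈⟨ +Sum.∑-distrib-+ (λ i → enum i) (λ _ → 1#) ⟨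
    Σ (λ i → enum i + 1#)               ≈⟨ sum-reindex +-commutativeMonoid translation (λ z → z) (λ z≈w → z≈w) ⟩
    Σ (λ i → enum i)                    ∎)
    where
    Σ = +Sum.sum {q}
    translation : Inverse setoid setoid
    translation = record
      { to        = _+ 1#
      ; from      = _+ - 1#
      ; to-cong   = +-congʳ
      ; from-cong = +-congʳ
      ; inverse   = (λ y≈x-1 → trans (+-congʳ y≈x-1) (cancel (-‿inverseˡ 1#)))
                  , (λ y≈x+1 → trans (+-congʳ y≈x+1) (cancel (-‿inverseʳ 1#)))
      }
      where
      cancel : ∀ {x u v} → u + v ≈ 0# → (x + u) + v ≈ x
      cancel u+v≈0 = trans (+-assoc _ _ _) (trans (+-congˡ u+v≈0) (+-identityʳ _))

  Invertible : Carrier → Set _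
  Invertible x = ∃ λ y → x * y ≈ 1#

  *-invertible : ∀ {x y} → Invertible x → Invertible y → Invertible (x * y)
  *-invertible {x} {y} (x⁻¹ , xx⁻¹≈1) (y⁻¹ , yy⁻¹≈1) = y⁻¹ * x⁻¹ , (begin
    (x * y) * (y⁻¹ * x⁻¹) ≈⟨ *-assoc _ _ _ ⟩
    x * (y * (y⁻¹ * x⁻¹)) ≈⟨ *-congˡ (*-assoc _ _ _) ⟨
    x * ((y * y⁻¹) * x⁻¹) ≈⟨ *-congˡ (trans (*-congʳ yy⁻¹≈1) (*-identityˡ x⁻¹)) ⟩
    x * x⁻¹               ≈⟨ xx⁻¹≈1 ⟩
    1#                    ∎)

  product-invertible : ∀ {n} (f : Fin n → Carrier) → (∀ i → Invertible (f i)) → Invertible (*Sum.sum f)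
  product-invertible {zero}  f _       = 1# , *-identityˡ 1#
  product-invertible {suc n} f f-units = *-invertible (f-units Fin.zero) (product-invertible (λ i → f (Fin.suc i)) (λ i → f-units (Fin.suc i)))

  invertible-cancelʳ : ∀ {x y z} → Invertible z → x * z ≈ y * z → x ≈ y
  invertible-cancelʳ {x} {y} {z} (z⁻¹ , zz⁻¹≈1) xz≈yz = begin
    x               ≈⟨ *-identityʳ x ⟨
    x * 1#          ≈⟨ *-congˡ zz⁻¹≈1 ⟨
    x * (z * z⁻¹)   ≈⟨ *-assoc _ _ _ ⟨
    (x * z) * z⁻¹   ≈⟨ *-congʳ xz≈yz ⟩
    (y * z) * z⁻¹   ≈⟨ *-assoc _ _ _ ⟩
    y * (z * z⁻¹)   ≈⟨ *-congˡ zz⁻¹≈1 ⟩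
    y * 1#          ≈⟨ *-identityʳ y ⟩
    y               ∎

  product-single : ∀ {n} (f : Fin n → Carrier) j → (∀ i → i ≢ j → f i ≈ 1#) → *Sum.sum f ≈ f j
  product-single {suc n} f j others = begin
    *Sum.sum f                              ≈⟨ *Sum.sum-remove f ⟩
    f j * *Sum.sum (λ k → f (Fin.punchIn j k)) ≈⟨ *-congˡ (*Sum.sum-cong-≋ (λ k → others _ (Fin.punchInᵢ≢i j k))) ⟩
    f j * *Sum.sum {n} (λ _ → 1#)           ≈⟨ *-congˡ (*Sum.sum-replicate-zero n) ⟩
    f j * 1#                                ≈⟨ *-identityʳ _ ⟩
    f j                                     ∎

  zeroToOne : Carrier → Carrier
  zeroToOne z with z ≈? 0#
  ... | yes _ = 1#
  ... | no _  = z

  zeroToOne-cong : ∀ {x y} → x ≈ y → zeroToOne x ≈ zeroToOne y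
  zeroToOne-cong {x} {y} x≈y with x ≈? 0# | y ≈? 0#
  ... | yes _   | yes _   = refl
  ... | yes x≈0 | no y≉0  = ⊥-elim (y≉0 (trans (sym x≈y) x≈0))
  ... | no x≉0  | yes y≈0 = ⊥-elim (x≉0 (trans x≈y y≈0))
  ... | no _    | no _    = x≈y

  zeroToOne-invertible : ∀ z → Invertible (zeroToOne z)
  zeroToOne-invertible z with z ≈? 0#
  ... | yes _  = 1# , *-identityˡ 1#
  ... | no z≉0 = inverse z z≉0

  -- Π h is the product of the nonzero elements, which multiplication by a permutes; aIfZero
  -- accounts for the factor contributed by 0, so a ^ q * Π h ≈ a * Π h.
  fermat-nonzero : ∀ {a} → ¬ (a ≈ 0#) → a ^R q ≈ a
  fermat-nonzero {a} a≉0 = invertible-cancelʳ (product-invertible h (λ i → zeroToOne-invertible (enum i))) (begin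
    a ^R q * Π h                                           ≈⟨ *-congʳ (*Sum.sum-replicate q) ⟨
    Π (λ _ → a) * Π h                                      ≈⟨ *Sum.∑-distrib-+ (λ _ → a) h ⟨
    Π (λ i → a * h i)                                      ≈⟨ *Sum.sum-cong-≋ (λ i → a*zeroToOne (enum i)) ⟩
    Π (λ i → aIfZero (enum i) * zeroToOne (a * enum i))    ≈⟨ *Sum.∑-distrib-+ {q} (λ i → aIfZero (enum i)) (λ i → zeroToOne (a * enum i)) ⟩
    Π (λ i → aIfZero (enum i)) * Π (λ i → zeroToOne (a * enum i))
                                                           ≈⟨ *-cong aIfZero-product (sum-reindex *-commutativeMonoid dilation zeroToOne zeroToOne-cong) ⟩
    a * Π h                                                ∎)
    where
    Π = *Sum.sum {q}
    h : Fin q → Carrier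
    h i = zeroToOne (enum i)
    a⁻¹ = proj₁ (inverse a a≉0)
    aa⁻¹≈1 = proj₂ (inverse a a≉0)
    a⁻¹a≈1 = trans (*-comm a⁻¹ a) aa⁻¹≈1
    dilation : Inverse setoid setoid
    dilation = record
      { to        = a *_
      ; from      = a⁻¹ *_
      ; to-cong   = *-congˡ
      ; from-cong = *-congˡ
      ; inverse   = (λ y≈a⁻¹x → trans (*-congˡ y≈a⁻¹x) (cancel aa⁻¹≈1))
                  , (λ y≈ax → trans (*-congˡ y≈ax) (cancel a⁻¹a≈1))
      }
      where
      cancel : ∀ {u v x} → u * v ≈ 1# → u * (v * x) ≈ x
      cancel uv≈1 = trans (sym (*-assoc _ _ _)) (trans (*-congʳ uv≈1) (*-identityˡ _))
    aIfZero : Carrier → Carrier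
    aIfZero z with z ≈? 0#
    ... | yes _ = a
    ... | no _  = 1#
    a*zeroToOne : ∀ z → a * zeroToOne z ≈ aIfZero z * zeroToOne (a * z)
    a*zeroToOne z with z ≈? 0# | (a * z) ≈? 0#
    ... | yes _   | yes _    = refl
    ... | yes z≈0 | no az≉0  = ⊥-elim (az≉0 (trans (*-congˡ z≈0) (zeroʳ a)))
    ... | no z≉0  | yes az≈0 = ⊥-elim (z≉0 (begin
      z               ≈⟨ *-identityˡ z ⟨
      1# * z          ≈⟨ *-congʳ a⁻¹a≈1 ⟨
      (a⁻¹ * a) * z   ≈⟨ *-assoc _ _ _ ⟩
      a⁻¹ * (a * z)   ≈⟨ *-congˡ az≈0 ⟩
      a⁻¹ * 0#        ≈⟨ zeroʳ a⁻¹ ⟩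
      0#              ∎))
    ... | no _    | no _     = sym (*-identityˡ _)
    aIfZero-product : Π (λ i → aIfZero (enum i)) ≈ a
    aIfZero-product = trans (product-single _ (index 0#) nonzero) (atZero (enum (index 0#)) (enum-index 0#))
      where
      nonzero : ∀ i → i ≢ index 0# → aIfZero (enum i) ≈ 1#
      nonzero i i≢i₀ with enum i ≈? 0#
      ... | yes eᵢ≈0 = ⊥-elim (i≢i₀ (enum-inj _ _ (trans eᵢ≈0 (sym (enum-index 0#)))))
      ... | no _     = refl
      atZero : ∀ z → z ≈ 0# → aIfZero z ≈ a
      atZero z z≈0 with z ≈? 0#
      ... | yes _  = refl
      ... | no z≉0 = ⊥-elim (z≉0 z≈0)

  fermat : ∀ a → a ^R q ≈ a
  fermat a with a ≈? 0#
  ... | no a≉0  = fermat-nonzero a≉0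
  ... | yes a≈0 = zero^ (index 0#)
    where
    zero^ : ∀ {n} → Fin n → a ^R n ≈ a
    zero^ {suc n} _ = trans (*-congʳ a≈0) (trans (zeroˡ _) (sym a≈0))

  fermat-^ : ∀ m a → a ^R (q ℕ.^ m) ≈ a
  fermat-^ zero    a = *-identityʳ a
  fermat-^ (suc m) a = begin
    a ^R (q ℕ.* q ℕ.^ m) ≈⟨ ^-assocʳ a q (q ℕ.^ m) ⟨
    (a ^R q) ^R (q ℕ.^ m) ≈⟨ ^-congˡ (q ℕ.^ m) (fermat a) ⟩
    a ^R (q ℕ.^ m)       ≈⟨ fermat-^ m a ⟩
    a                    ∎

  natR-^ : ∀ p k → natR (p ℕ.^ k) ≈ natR p ^R k
  natR-^ p zero    = +-identityʳ 1#
  natR-^ p (suc k) = trans (natR-* p (p ℕ.^ k)) (*-congˡ (natR-^ p k))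

  natR-base≈0 : ∀ {p k} → q ≡ p ℕ.^ k → natR p ≈ 0#
  natR-base≈0 {p} {k} q≡p^k with natR p ≈? 0#
  ... | yes natR-p≈0 = natR-p≈0
  ... | no natR-p≉0  = ⊥-elim (1≉0 (begin
    1#                              ≈⟨ 1^ k ⟨
    1# ^R k                         ≈⟨ ^-congˡ k w ⟨
    (natR p * p⁻¹) ^R k             ≈⟨ ^-distrib-* (natR p) p⁻¹ k ⟩
    natR p ^R k * p⁻¹ ^R k          ≈⟨ *-congʳ (natR-^ p k) ⟨
    natR (p ℕ.^ k) * p⁻¹ ^R k       ≈⟨ *-congʳ (reflexive (≡.cong natR (≡.sym q≡p^k))) ⟩
    natR q * p⁻¹ ^R k               ≈⟨ *-congʳ natR[q]≈0 ⟩
    0# * p⁻¹ ^R k                   ≈⟨ zeroˡ _ ⟩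
    0#                              ∎))
    where
    p⁻¹ = proj₁ (inverse (natR p) natR-p≉0)
    w = proj₂ (inverse (natR p) natR-p≉0)
    1^ : ∀ n → 1# ^R n ≈ 1#
    1^ zero    = refl
    1^ (suc n) = trans (*-identityˡ _) (1^ n)

open import Level using (Level)
open import Data.Nat using (_^_; _+_)
open import Data.Product using (_×_; ∃₂)

mainTheorem9 : ∀ {c ℓ : Level} (q : ℕ)
  → ∃₂ (λ p k → Prime p × 1 ≤ k × q ≡ p ^ k)
  → (F : FiniteField q c ℓ)
  → let open PowerSeries (FiniteField.commRing F) in
    ∀ (m r : ℕ) → r < q ^ m → ∀ (x : PS)
    → ((Δ q r m x) ^PS (q ^ m))
        ≋ sumPS (q ^ m ∸ r) (λ j →
            scale (natR ((r + j) C r)) ((negPS T ^PS j) ⊛ D (r + j) x))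
      × ((Δ q (q ^ m ∸ 1) m x) ^PS (q ^ m)) ≋ D (q ^ m ∸ 1) x
mainTheorem9 q (p , k , p-prime , _ , q≡p^k) F m r r<q^m x =
  Δ-power r<q^m (fermat-^ m) x , Δ-power-last (fermat-^ m) x
  where
  open FiniteFieldProperties F
  open PowerSeriesProperties (FiniteField.commRing F)
  open PowerOfCharacteristic p-prime (natR-base≈0 {p} {k} q≡p^k) (k ℕ.* m) (≡.trans (≡.cong (_^ m) q≡p^k) (ℕ.^-*-assoc p k m))
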